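{- Let $w\in\{0,1\}^*$ be a prefix normal word which is a palindrome and contains at least one $0$. Then the word $w1$ is not prefix normal.
   Context: For a word $w$, $|w|_1$ denotes the number of $1$s in $w$ and $\mathrm{pref}_k(w)$ its prefix of length $k$; a factor is a contiguous subword. A word $w$ is prefix normal if every factor $v$ of $w$ satisfies $|v|_1 \le |\mathrm{pref}_{|v|}(w)|_1$. A palindrome is a word equal to its reversal. -}

module Defs where

open import Data.Bool using (Bool; true; false)
open import Data.List using (List; []; _∷_; _++_; length; take; reverse)
open import Data.Nat using (ℕ; zero; suc; _≤_)
open import Data.Product using (∃₂)
open import Relation.Binary.PropositionalEquality using (_≡_)

-- A binary word: 0 is false, 1 is true.
Word : Set
Word = List Bool

ones : Word → ℕ
ones []          = zero
ones (true ∷ w)  = suc (ones w)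
ones (false ∷ w) = ones w

IsFactor : Word → Word → Set
IsFactor v w = ∃₂ λ x y → w ≡ x ++ v ++ y

PrefixNormal : Word → Set
PrefixNormal w = ∀ v → IsFactor v w → ones v ≤ ones (take (length v) w)

Palindrome : Word → Set
Palindrome w = reverse w ≡ w

{-# OPTIONS --safe #-}
module Submission where

-- Write w = 1^k 0 u, with 1^k the leading run of 1s. Being a palindrome, w also ends
-- in 0 1^k, so w1 ends in the factor 1^(k+1), which has more 1s than the prefix
-- 1^k 0 of w1 of the same length.

open import Defs
open import Data.Bool using (true; false)
open import Data.List using ([]; _∷_; _++_; _∷ʳ_; [_]; replicate; reverse; take; length)
open import Data.List.Properties using (length-replicate; reverse-++; ++-assoc; ++-identityʳ; unfold-reverse)
open import Data.List.Membership.Propositional using (_∈_)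
open import Data.List.Relation.Unary.Any using (there)
open import Data.Nat using (zero; suc)
open import Data.Nat.Properties using (1+n≰n; module ≤-Reasoning)
open import Data.Product using (∃₂; _,_)
open import Relation.Nullary using (¬_)
open import Relation.Binary.PropositionalEquality using (_≡_; refl; sym; trans; cong; subst; module ≡-Reasoning)

module _ {a} {A : Set a} where

  replicate-∷ʳ : ∀ n (x : A) → replicate n x ∷ʳ x ≡ x ∷ replicate n x
  replicate-∷ʳ zero    x = refl
  replicate-∷ʳ (suc n) x = cong (x ∷_) (replicate-∷ʳ n x)

  reverse-replicate : ∀ n (x : A) → reverse (replicate n x) ≡ replicate n x
  reverse-replicate zero    x = refl
  reverse-replicate (suc n) x = begin
    reverse (x ∷ replicate n x)   ≡⟨ unfold-reverse x (replicate n x) ⟩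
    reverse (replicate n x) ∷ʳ x  ≡⟨ cong (_∷ʳ x) (reverse-replicate n x) ⟩
    replicate n x ∷ʳ x            ≡⟨ replicate-∷ʳ n x ⟩
    x ∷ replicate n x             ∎
    where open ≡-Reasoning

isFactor-suffix : ∀ x v → IsFactor v (x ++ v)
isFactor-suffix x v = x , [] , cong (x ++_) (sym (++-identityʳ v))

palindrome-++ : ∀ {w} xs ys → Palindrome w → w ≡ xs ++ ys → w ≡ reverse ys ++ reverse xs
palindrome-++ {w} xs ys pal w≡ = begin
  w                      ≡⟨ pal ⟨
  reverse w              ≡⟨ cong reverse w≡ ⟩
  reverse (xs ++ ys)     ≡⟨ reverse-++ xs ys ⟩
  reverse ys ++ reverse xs ∎
  where open ≡-Reasoning

ones-replicate-true : ∀ n → ones (replicate n true) ≡ n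
ones-replicate-true zero    = refl
ones-replicate-true (suc n) = cong suc (ones-replicate-true n)

ones-take-leadingRun : ∀ k u → ones (take (suc k) (replicate k true ++ false ∷ u)) ≡ k
ones-take-leadingRun zero    u = refl
ones-take-leadingRun (suc k) u = cong suc (ones-take-leadingRun k u)

∈-false⇒leadingRun : ∀ {w} → false ∈ w → ∃₂ λ k u → w ≡ replicate k true ++ false ∷ u
∈-false⇒leadingRun {false ∷ w} _         = 0 , w , refl
∈-false⇒leadingRun {true ∷ w}  (there p) with k , u , w≡ ← ∈-false⇒leadingRun p
  = suc k , u , cong (true ∷_) w≡

prefixNormal⇒¬longerRun : ∀ k u → PrefixNormal (replicate k true ++ false ∷ u)
  → ¬ IsFactor (replicate (suc k) true) (replicate k true ++ false ∷ u)
prefixNormal⇒¬longerRun k u pn run∈w = 1+n≰n (begin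
  suc k                            ≡⟨ ones-replicate-true (suc k) ⟨
  ones run                         ≤⟨ pn run run∈w ⟩
  ones (take (length run) w)       ≡⟨ cong (λ n → ones (take n w)) (length-replicate (suc k)) ⟩
  ones (take (suc k) w)            ≡⟨ ones-take-leadingRun k u ⟩
  k                                ∎)
  where
  open ≤-Reasoning
  run = replicate (suc k) true
  w   = replicate k true ++ false ∷ u

palindrome⇒trailingRun : ∀ {w} k u → Palindrome w → w ≡ replicate k true ++ false ∷ u
  → w ≡ reverse (false ∷ u) ++ replicate k true
palindrome⇒trailingRun k u pal w≡ =
  trans (palindrome-++ (replicate k true) (false ∷ u) pal w≡)
        (cong (reverse (false ∷ u) ++_) (reverse-replicate k true))

mainTheorem7 : (w : Word) → PrefixNormal w → Palindrome w → false ∈ w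
    → ¬ PrefixNormal (w ++ [ true ])
mainTheorem7 w _ pal false∈w pn with k , u , w≡ ← ∈-false⇒leadingRun false∈w =
  prefixNormal⇒¬longerRun k (u ++ [ true ]) (subst PrefixNormal w1≡ pn) (subst (IsFactor _) w1≡ endsInRun)
  where
  open ≡-Reasoning
  w1≡ : w ++ [ true ] ≡ replicate k true ++ false ∷ (u ++ [ true ])
  w1≡ = trans (cong (_++ [ true ]) w≡) (++-assoc (replicate k true) (false ∷ u) [ true ])
  endsInRun : IsFactor (replicate (suc k) true) (w ++ [ true ])
  endsInRun = subst (IsFactor _) (sym (begin
    w ++ [ true ]                                    ≡⟨ cong (_∷ʳ true) (palindrome⇒trailingRun k u pal w≡) ⟩
    (reverse (false ∷ u) ++ replicate k true) ∷ʳ true ≡⟨ ++-assoc (reverse (false ∷ u)) (replicate k true) [ true ] ⟩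
    reverse (false ∷ u) ++ replicate k true ∷ʳ true   ≡⟨ cong (reverse (false ∷ u) ++_) (replicate-∷ʳ k true) ⟩
    reverse (false ∷ u) ++ replicate (suc k) true     ∎))
    (isFactor-suffix (reverse (false ∷ u)) (replicate (suc k) true))
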